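{- Let $G_1, G_2, \dots, G_n$ be simple connected graphs with pairwise disjoint vertex sets, and let $G_{n_G}$ be the graph obtained from the disjoint union $\bigcup_i G_i$ by adding every edge $vu$ with $v \in V(G_i)$, $u \in V(G_j)$, $i \neq j$. Then $\Upsilon(G_{n_G}) = \sum_{i} \Upsilon(G_i)$.
   Context: Vertex explosions: start with $G'_0 = G$ (with underlying graph $G^*_0 = G$). Given the mixed graph $G'_i$ (the graph $G$ together with the arcs added so far) with underlying simple graph $G^*_i$, exploding a vertex $w$ produces $G'_{i+1}$ by adding an arc $(w,z)$ for every vertex $z \neq w$ that is not adjacent to $w$ in $G^*_i$. The McPherson number $\Upsilon(G)$ of a graph $G$ on $m$ vertices is the minimum number $\ell$ of successive vertex explosions after which the underlying graph $G^*_\ell$ is isomorphic to the complete graph $K_m$. -}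

module Defs where

open import Level using (0ℓ)
open import Data.Nat using (ℕ; zero; suc; _+_; _<_; _≥_)
open import Data.Fin using (Fin; zero; suc; _≟_)
open import Data.Product using (Σ; _×_; _,_; proj₁; proj₂)
open import Data.Sum using (_⊎_; inj₁; inj₂)
open import Data.Empty using (⊥)
open import Data.Unit using (⊤; tt)
open import Data.List using (List; []; _∷_)
open import Data.Vec using (Vec; toList)
open import Relation.Nullary using (¬_; yes; no)
open import Relation.Binary.PropositionalEquality using (_≡_; _≢_; refl; sym)
open import Relation.Binary.Construct.Closure.ReflexiveTransitive using (Star)
open import Function.Bundles using (_↔_; _⇔_; Inverse)

record Graph (V : Set) : Set₁ where
  field
    Adj    : V → V → Set
    adjSym : ∀ {x y} → Adj x y → Adj y x
    adjIrr : ∀ {x} → ¬ Adj x x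
open Graph public

Connected : ∀ {V} → Graph V → Set
Connected {V} G = V × (∀ x y → Star (Adj G) x y)

-- The state of the mixed graph G'_i is G together
-- with a set of arcs; its underlying simple graph G*_i has x ~ y iff
-- xy is an edge of G or one of the arcs (x,y), (y,x) has been added.

Underlying : ∀ {V} → Graph V → (V → V → Set) → V → V → Set
Underlying G Arc x y = Adj G x y ⊎ (Arc x y ⊎ Arc y x)

explode : ∀ {V} → Graph V → (V → V → Set) → V → (V → V → Set)
explode G Arc w x z = Arc x z ⊎ (x ≡ w × (z ≢ w × ¬ Underlying G Arc w z))

explodeAll : ∀ {V} → Graph V → (V → V → Set) → List V → (V → V → Set)
explodeAll G Arc []       = Arc
explodeAll G Arc (w ∷ ws) = explodeAll G (explode G Arc w) ws

noArcs : ∀ {V : Set} → V → V → Set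
noArcs _ _ = ⊥

afterExplosions : ∀ {V} → Graph V → List V → V → V → Set
afterExplosions G ws = Underlying G (explodeAll G noArcs ws)

IsoToComplete : ∀ {V : Set} → ℕ → (V → V → Set) → Set
IsoToComplete {V} m R =
  Σ (V ↔ Fin m) λ f → ∀ x y → R x y ⇔ (Inverse.to f x ≢ Inverse.to f y)

CompletableIn : ∀ {V} → Graph V → (m ℓ : ℕ) → Set
CompletableIn G m ℓ =
  Σ (Vec _ ℓ) λ ws → IsoToComplete m (afterExplosions G (toList ws))

-- Υ(G) = ℓ  for a graph G on m vertices: ℓ is the minimum such number.
McPherson : ∀ {V} → Graph V → (m ℓ : ℕ) → Set
McPherson G m ℓ = CompletableIn G m ℓ × (∀ k → k < ℓ → ¬ CompletableIn G m k)

∑ : (n : ℕ) → (Fin n → ℕ) → ℕ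
∑ zero    f = 0
∑ (suc n) f = f zero + ∑ n (λ i → f (suc i))

-- The join G_{n_G} of graphs G_i on pairwise disjoint vertex sets
-- (vertex set Σ i. Fin (ms i)): disjoint union plus all edges between
-- different G_i's.

JoinV : (n : ℕ) → (Fin n → ℕ) → Set
JoinV n ms = Σ (Fin n) λ i → Fin (ms i)

JoinAdj : ∀ {n} (ms : Fin n → ℕ) → ((i : Fin n) → Graph (Fin (ms i)))
        → JoinV n ms → JoinV n ms → Set
JoinAdj ms Gs (i , x) (j , y) with i ≟ j
... | yes refl = Adj (Gs i) x y
... | no _     = ⊤

private
  joinSym : ∀ {n} (ms : Fin n → ℕ) (Gs : (i : Fin n) → Graph (Fin (ms i)))
          → ∀ p q → JoinAdj ms Gs p q → JoinAdj ms Gs q p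
  joinSym ms Gs (i , x) (j , y) a with i ≟ j | j ≟ i
  ... | yes refl | yes refl = adjSym (Gs i) a
  ... | yes refl | no ne    = tt
  ... | no ne    | yes refl = ⊥-elim' (ne refl)
    where ⊥-elim' : ⊥ → _
          ⊥-elim' ()
  ... | no _     | no _     = tt

  joinIrr : ∀ {n} (ms : Fin n → ℕ) (Gs : (i : Fin n) → Graph (Fin (ms i)))
          → ∀ p → ¬ JoinAdj ms Gs p p
  joinIrr ms Gs (i , x) a with i ≟ i
  ... | yes refl = adjIrr (Gs i) a
  ... | no ne    = ne refl

Join : ∀ {n} (ms : Fin n → ℕ) → ((i : Fin n) → Graph (Fin (ms i)))
     → Graph (JoinV n ms)
Join ms Gs = record
  { Adj    = JoinAdj ms Gs
  ; adjSym = λ {p} {q} → joinSym ms Gs p q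
  ; adjIrr = λ {p} → joinIrr ms Gs p
  }

-- Every vertex of the join is adjacent to all vertices outside its own block, so exploding
-- a vertex of block i only adds arcs inside block i.  Hence the explosions of a sequence that
-- lie in block i act on the block exactly as the subsequence of them acts on Gᵢ, and the join
-- becomes complete iff every block does.  Concatenating optimal sequences of the blocks gives
-- ∑ Υ(Gᵢ) explosions that suffice; conversely any completing sequence of the join contains at
-- least Υ(Gᵢ) explosions in each block i.

module Submission where

open import Defs
open import Data.Nat using (ℕ; zero; suc; _+_; _≤_; z≤n)
open import Data.Nat.Properties
  using (+-mono-≤; +-commutativeSemigroup; <⇒≱; ≮⇒≥; module ≤-Reasoning)
open import Algebra.Properties.CommutativeSemigroup +-commutativeSemigroup
  using (interchange)
open import Data.Fin using (Fin; zero; suc; _≟_)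
open import Data.Fin.Properties using (suc-injective; +↔⊎)
open import Data.Product using (_,_; proj₁; proj₂)
open import Data.Product.Properties using (,-injectiveˡ)
open import Data.Sum as Sum using (_⊎_; inj₁; inj₂; [_,_])
open import Data.Empty using (⊥-elim)
open import Data.Unit using (tt)
open import Data.List as List using (List; []; _∷_; _++_; length)
open import Data.List.Properties using (++-identityʳ)
open import Data.Vec using (toList; fromList)
open import Data.Vec.Properties using (toList∘fromList; length-toList)
open import Function using (id; _∘′_)
open import Function.Bundles
  using (_↔_; _⇔_; Inverse; Injection; Equivalence; mk⇔; mk↔ₛ′)
open import Function.Properties.Inverse using (↔-refl; ↔-trans; ↔-sym; Inverse⇒Injection)
open import Data.Sum.Function.Propositional using (_⊎-↔_)
open import Relation.Nullary using (¬_; Dec; yes; no)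
open import Relation.Binary.PropositionalEquality
  using (_≡_; _≢_; refl; sym; trans; cong; cong₂; subst; module ≡-Reasoning)

open Equivalence using (to; from)

Complete : ∀ {V : Set} → (V → V → Set) → Set
Complete R = ∀ x y → x ≢ y → R x y

module _ {V : Set} (G : Graph V) where

  explode-irreflexive : ∀ {Arc} → (∀ x → ¬ Arc x x) → ∀ w x → ¬ explode G Arc w x x
  explode-irreflexive irr w x (inj₁ a)               = irr x a
  explode-irreflexive irr w x (inj₂ (x≡w , x≢w , _)) = x≢w x≡w

  explodeAll-irreflexive : ∀ {Arc} → (∀ x → ¬ Arc x x) → ∀ ws x → ¬ explodeAll G Arc ws x x
  explodeAll-irreflexive irr []       = irr
  explodeAll-irreflexive irr (w ∷ ws) = explodeAll-irreflexive (explode-irreflexive irr w) ws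

  afterExplosions-irreflexive : ∀ ws x → ¬ afterExplosions G ws x x
  afterExplosions-irreflexive ws x (inj₁ a)        = adjIrr G a
  afterExplosions-irreflexive ws x (inj₂ (inj₁ a)) = explodeAll-irreflexive (λ _ ()) ws x a
  afterExplosions-irreflexive ws x (inj₂ (inj₂ a)) = explodeAll-irreflexive (λ _ ()) ws x a

  completableIn-fromList : ∀ {m} (ws : List V) →
    IsoToComplete m (afterExplosions G ws) → CompletableIn G m (length ws)
  completableIn-fromList ws iso =
    fromList ws , subst (λ us → IsoToComplete _ (afterExplosions G us)) (sym (toList∘fromList ws)) iso

  McPherson-minimal : ∀ {m ℓ} → McPherson G m ℓ →
    (ws : List V) → IsoToComplete m (afterExplosions G ws) → ℓ ≤ length ws
  McPherson-minimal (_ , minimal) ws iso = ≮⇒≥ λ shorter → minimal _ shorter (completableIn-fromList ws iso)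

module _ {V : Set} {m : ℕ} {R : V → V → Set} where

  IsoToComplete⇒Complete : IsoToComplete m R → Complete R
  IsoToComplete⇒Complete (f , iso) x y x≢y =
    from (iso x y) (λ fx≡fy → x≢y (Injection.injective (Inverse⇒Injection f) fx≡fy))

  Complete⇒IsoToComplete : V ↔ Fin m → (∀ x → ¬ R x x) → Complete R → IsoToComplete m R
  Complete⇒IsoToComplete f irr complete = f , λ x y → mk⇔
    (λ r fx≡fy → irr x (subst (R x) (sym (Injection.injective (Inverse⇒Injection f) fx≡fy)) r))
    (λ fx≢fy → complete x y (λ x≡y → fx≢fy (cong (Inverse.to f) x≡y)))

∑-cong : ∀ n {f g : Fin n → ℕ} → (∀ i → f i ≡ g i) → ∑ n f ≡ ∑ n g
∑-cong zero    f≗g = refl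
∑-cong (suc n) f≗g = cong₂ _+_ (f≗g zero) (∑-cong n (λ i → f≗g (suc i)))

∑-mono-≤ : ∀ n {f g : Fin n → ℕ} → (∀ i → f i ≤ g i) → ∑ n f ≤ ∑ n g
∑-mono-≤ zero    f≤g = z≤n
∑-mono-≤ (suc n) f≤g = +-mono-≤ (f≤g zero) (∑-mono-≤ n (λ i → f≤g (suc i)))

∑-distrib-+ : ∀ n (f g : Fin n → ℕ) → ∑ n (λ i → f i + g i) ≡ ∑ n f + ∑ n g
∑-distrib-+ zero    f g = refl
∑-distrib-+ (suc n) f g =
  trans (cong (f zero + g zero +_) (∑-distrib-+ n (λ i → f (suc i)) (λ i → g (suc i))))
        (interchange (f zero) (g zero) _ _)

∑-zero : ∀ n → ∑ n (λ _ → 0) ≡ 0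
∑-zero zero    = refl
∑-zero (suc n) = ∑-zero n

δ : ∀ {n} → Fin n → Fin n → ℕ
δ zero    zero    = 1
δ zero    (suc _) = 0
δ (suc _) zero    = 0
δ (suc k) (suc i) = δ k i

δ-refl : ∀ {n} (k : Fin n) → δ k k ≡ 1
δ-refl zero    = refl
δ-refl (suc k) = δ-refl k

δ-≢ : ∀ {n} {k i : Fin n} → k ≢ i → δ k i ≡ 0
δ-≢ {k = zero}  {zero}  k≢i = ⊥-elim (k≢i refl)
δ-≢ {k = zero}  {suc i} k≢i = refl
δ-≢ {k = suc k} {zero}  k≢i = refl
δ-≢ {k = suc k} {suc i} k≢i = δ-≢ (k≢i ∘′ cong suc)

∑-δ : ∀ n (k : Fin n) → ∑ n (δ k) ≡ 1
∑-δ (suc n) zero    = cong suc (∑-zero n)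
∑-δ (suc n) (suc k) = ∑-δ n k

JoinV↔Fin∑ : ∀ n (ms : Fin n → ℕ) → JoinV n ms ↔ Fin (∑ n ms)
JoinV↔Fin∑ zero    ms = mk↔ₛ′ (λ { (() , _) }) (λ ()) (λ ()) (λ { (() , _) })
JoinV↔Fin∑ (suc n) ms =
  ↔-trans splitFirst (↔-trans (↔-refl ⊎-↔ JoinV↔Fin∑ n (ms ∘′ suc)) (↔-sym (+↔⊎ {ms zero})))
  where
  splitFirst : JoinV (suc n) ms ↔ (Fin (ms zero) ⊎ JoinV n (ms ∘′ suc))
  splitFirst = mk↔ₛ′
    (λ { (zero , x) → inj₁ x ; (suc j , x) → inj₂ (j , x) })
    (λ { (inj₁ x) → zero , x ; (inj₂ (j , x)) → suc j , x })
    (λ { (inj₁ x) → refl ; (inj₂ (j , x)) → refl })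
    (λ { (zero , x) → refl ; (suc j , x) → refl })

restrict : ∀ {n} (ms : Fin n → ℕ) (i : Fin n) → List (JoinV n ms) → List (Fin (ms i))
restrict ms i []             = []
restrict ms i ((k , w) ∷ ws) with k ≟ i
... | yes refl = w ∷ restrict ms i ws
... | no  _    = restrict ms i ws

length-restrict-∷ : ∀ {n} (ms : Fin n → ℕ) i k w ws →
  length (restrict ms i ((k , w) ∷ ws)) ≡ δ k i + length (restrict ms i ws)
length-restrict-∷ ms i k w ws with k ≟ i
... | yes refl = cong (_+ length (restrict ms k ws)) (sym (δ-refl k))
... | no  k≢i  = cong (_+ length (restrict ms i ws)) (sym (δ-≢ k≢i))

∑-length-restrict : ∀ {n} (ms : Fin n → ℕ) (ws : List (JoinV n ms)) →
  ∑ n (λ i → length (restrict ms i ws)) ≡ length ws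
∑-length-restrict {n} ms []             = ∑-zero n
∑-length-restrict {n} ms ((k , w) ∷ ws) = begin
  ∑ n (λ i → length (restrict ms i ((k , w) ∷ ws)))   ≡⟨ ∑-cong n (λ i → length-restrict-∷ ms i k w ws) ⟩
  ∑ n (λ i → δ k i + length (restrict ms i ws))        ≡⟨ ∑-distrib-+ n (δ k) _ ⟩
  ∑ n (δ k) + ∑ n (λ i → length (restrict ms i ws))    ≡⟨ cong₂ _+_ (∑-δ n k) (∑-length-restrict ms ws) ⟩
  suc (length ws)                                      ∎
  where open ≡-Reasoning

restrict-++ : ∀ {n} (ms : Fin n → ℕ) i (xs ys : List (JoinV n ms)) →
  restrict ms i (xs ++ ys) ≡ restrict ms i xs ++ restrict ms i ys
restrict-++ ms i []             ys = refl
restrict-++ ms i ((k , w) ∷ xs) ys with k ≟ i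
... | yes refl = cong (w ∷_) (restrict-++ ms i xs ys)
... | no  _    = restrict-++ ms i xs ys

restrict-map-, : ∀ {n} (ms : Fin n → ℕ) i (xs : List (Fin (ms i))) →
  restrict ms i (List.map (i ,_) xs) ≡ xs
restrict-map-, ms i []       = refl
restrict-map-, ms i (x ∷ xs) with i ≟ i
... | yes refl = cong (x ∷_) (restrict-map-, ms i xs)
... | no  i≢i  = ⊥-elim (i≢i refl)

restrict-map-,-≢ : ∀ {n} (ms : Fin n → ℕ) {k i} → k ≢ i → (xs : List (Fin (ms k))) →
  restrict ms i (List.map (k ,_) xs) ≡ []
restrict-map-,-≢ ms k≢i []       = refl
restrict-map-,-≢ ms {k} {i} k≢i (x ∷ xs) with k ≟ i
... | yes k≡i = ⊥-elim (k≢i k≡i)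
... | no  _   = restrict-map-,-≢ ms k≢i xs

shift : ∀ {n} {ms : Fin (suc n) → ℕ} → JoinV n (ms ∘′ suc) → JoinV (suc n) ms
shift (j , x) = suc j , x

restrict-zero-shift : ∀ {n} (ms : Fin (suc n) → ℕ) (xs : List (JoinV n (ms ∘′ suc))) →
  restrict ms zero (List.map shift xs) ≡ []
restrict-zero-shift ms []       = refl
restrict-zero-shift ms (x ∷ xs) = restrict-zero-shift ms xs

restrict-suc-shift : ∀ {n} (ms : Fin (suc n) → ℕ) i (xs : List (JoinV n (ms ∘′ suc))) →
  restrict ms (suc i) (List.map shift xs) ≡ restrict (ms ∘′ suc) i xs
restrict-suc-shift ms i []             = refl
restrict-suc-shift ms i ((j , x) ∷ xs) with j ≟ i | suc j ≟ suc i
... | yes refl | yes refl = cong (x ∷_) (restrict-suc-shift ms i xs)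
... | yes refl | no  i≢i  = ⊥-elim (i≢i refl)
... | no  j≢i  | yes sj≡si = ⊥-elim (j≢i (suc-injective sj≡si))
... | no  _    | no  _    = restrict-suc-shift ms i xs

glue : ∀ n (ms : Fin n → ℕ) → (∀ i → List (Fin (ms i))) → List (JoinV n ms)
glue zero    ms Ls = []
glue (suc n) ms Ls = List.map (zero ,_) (Ls zero) ++ List.map shift (glue n (ms ∘′ suc) (λ i → Ls (suc i)))

restrict-glue : ∀ n (ms : Fin n → ℕ) Ls i → restrict ms i (glue n ms Ls) ≡ Ls i
restrict-glue (suc n) ms Ls zero = begin
  restrict ms zero (List.map (zero ,_) (Ls zero) ++ List.map shift rest)
    ≡⟨ restrict-++ ms zero (List.map (zero ,_) (Ls zero)) _ ⟩
  restrict ms zero (List.map (zero ,_) (Ls zero)) ++ restrict ms zero (List.map shift rest)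
    ≡⟨ cong₂ _++_ (restrict-map-, ms zero (Ls zero)) (restrict-zero-shift ms rest) ⟩
  Ls zero ++ []
    ≡⟨ ++-identityʳ (Ls zero) ⟩
  Ls zero ∎
  where
  open ≡-Reasoning
  rest = glue n (ms ∘′ suc) (λ i → Ls (suc i))
restrict-glue (suc n) ms Ls (suc i) = begin
  restrict ms (suc i) (List.map (zero ,_) (Ls zero) ++ List.map shift rest)
    ≡⟨ restrict-++ ms (suc i) (List.map (zero ,_) (Ls zero)) _ ⟩
  restrict ms (suc i) (List.map (zero ,_) (Ls zero)) ++ restrict ms (suc i) (List.map shift rest)
    ≡⟨ cong₂ _++_ (restrict-map-,-≢ ms (λ ()) (Ls zero)) (restrict-suc-shift ms i rest) ⟩
  restrict (ms ∘′ suc) i rest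
    ≡⟨ restrict-glue n (ms ∘′ suc) (λ i → Ls (suc i)) i ⟩
  Ls (suc i) ∎
  where
  open ≡-Reasoning
  rest = glue n (ms ∘′ suc) (λ i → Ls (suc i))

length-glue : ∀ n (ms : Fin n → ℕ) Ls → length (glue n ms Ls) ≡ ∑ n (λ i → length (Ls i))
length-glue n ms Ls = begin
  length (glue n ms Ls)                             ≡⟨ ∑-length-restrict ms (glue n ms Ls) ⟨
  ∑ n (λ i → length (restrict ms i (glue n ms Ls))) ≡⟨ ∑-cong n (λ i → cong length (restrict-glue n ms Ls i)) ⟩
  ∑ n (λ i → length (Ls i))                         ∎
  where open ≡-Reasoning

-- Explosions in a join, seen from one block

module _ {n : ℕ} (ms : Fin n → ℕ) (Gs : (i : Fin n) → Graph (Fin (ms i))) where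

  private
    G = Join ms Gs

  inBlock-injective : ∀ {i} {x y : Fin (ms i)} → _≡_ {A = JoinV n ms} (i , x) (i , y) → x ≡ y
  inBlock-injective refl = refl

  joinAdj-inBlock : ∀ i x y → JoinAdj ms Gs (i , x) (i , y) ⇔ Adj (Gs i) x y
  joinAdj-inBlock i x y with i ≟ i
  ... | yes refl = mk⇔ id id
  ... | no  i≢i  = ⊥-elim (i≢i refl)

  joinAdj-acrossBlocks : ∀ {i j} x y → i ≢ j → JoinAdj ms Gs (i , x) (j , y)
  joinAdj-acrossBlocks {i} {j} x y i≢j with i ≟ j
  ... | yes i≡j = ⊥-elim (i≢j i≡j)
  ... | no  _   = tt

  record RestrictsTo (i : Fin n) (Arc : JoinV n ms → JoinV n ms → Set)
                     (Arcᵢ : Fin (ms i) → Fin (ms i) → Set) : Set where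
    constructor restrictsTo
    field onBlock : ∀ x y → Arc (i , x) (i , y) ⇔ Arcᵢ x y
  open RestrictsTo

  underlying-restrictsTo : ∀ {i Arc Arcᵢ} → RestrictsTo i Arc Arcᵢ →
    ∀ x y → Underlying G Arc (i , x) (i , y) ⇔ Underlying (Gs i) Arcᵢ x y
  underlying-restrictsTo {i} (restrictsTo r) x y = mk⇔
    (Sum.map (to adj) (Sum.map (to (r x y)) (to (r y x))))
    (Sum.map (from adj) (Sum.map (from (r x y)) (from (r y x))))
    where adj = joinAdj-inBlock i x y

  explode-inBlock : ∀ {i Arc Arcᵢ} w → RestrictsTo i Arc Arcᵢ →
    RestrictsTo i (explode G Arc (i , w)) (explode (Gs i) Arcᵢ w)
  explode-inBlock {i} w r = restrictsTo λ x y → mk⇔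
    (Sum.map (to (onBlock r x y))
      λ { (x≡w , y≢w , unjoined) →
          inBlock-injective x≡w , y≢w ∘′ cong (i ,_) , unjoined ∘′ from (underlying-restrictsTo r w y) })
    (Sum.map (from (onBlock r x y))
      λ { (x≡w , y≢w , unjoined) →
          cong (i ,_) x≡w , y≢w ∘′ inBlock-injective , unjoined ∘′ to (underlying-restrictsTo r w y) })

  explode-outOfBlock : ∀ {i Arc Arcᵢ k} w → k ≢ i → RestrictsTo i Arc Arcᵢ →
    RestrictsTo i (explode G Arc (k , w)) Arcᵢ
  explode-outOfBlock w k≢i r = restrictsTo λ x y → mk⇔
    [ to (onBlock r x y) , (λ (x≡w , _) → ⊥-elim (k≢i (sym (,-injectiveˡ x≡w)))) ]
    (inj₁ ∘′ from (onBlock r x y))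

  explodeAll-restrictsTo : ∀ {i Arc Arcᵢ} ws → RestrictsTo i Arc Arcᵢ →
    RestrictsTo i (explodeAll G Arc ws) (explodeAll (Gs i) Arcᵢ (restrict ms i ws))
  explodeAll-restrictsTo             []             r = r
  explodeAll-restrictsTo {i} ((k , w) ∷ ws) r with k ≟ i
  ... | yes refl = explodeAll-restrictsTo ws (explode-inBlock w r)
  ... | no  k≢i  = explodeAll-restrictsTo ws (explode-outOfBlock w k≢i r)

  afterExplosions-inBlock : ∀ i ws x y →
    afterExplosions G ws (i , x) (i , y) ⇔ afterExplosions (Gs i) (restrict ms i ws) x y
  afterExplosions-inBlock i ws =
    underlying-restrictsTo (explodeAll-restrictsTo ws (restrictsTo λ _ _ → mk⇔ (λ ()) (λ ())))

  Complete-join⇒Complete-block : ∀ ws i →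
    Complete (afterExplosions G ws) → Complete (afterExplosions (Gs i) (restrict ms i ws))
  Complete-join⇒Complete-block ws i complete x y x≢y =
    to (afterExplosions-inBlock i ws x y) (complete (i , x) (i , y) (x≢y ∘′ inBlock-injective))

  Complete-blocks⇒Complete-join : ∀ ws →
    (∀ i → Complete (afterExplosions (Gs i) (restrict ms i ws))) → Complete (afterExplosions G ws)
  Complete-blocks⇒Complete-join ws complete (i , x) (j , y) = byBlocks (i ≟ j) x y
    where
    byBlocks : ∀ {i j} → Dec (i ≡ j) → ∀ x y → (i , x) ≢ (j , y) → afterExplosions G ws (i , x) (j , y)
    byBlocks (no  i≢j)  x y _   = inj₁ (joinAdj-acrossBlocks x y i≢j)
    byBlocks {i} (yes refl) x y xy≢ =
      from (afterExplosions-inBlock i ws x y) (complete i x y (xy≢ ∘′ cong (i ,_)))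

  CompletableIn-join-∑ : ∀ {ℓs : Fin n → ℕ} → (∀ i → CompletableIn (Gs i) (ms i) (ℓs i)) →
    CompletableIn G (∑ n ms) (∑ n ℓs)
  CompletableIn-join-∑ {ℓs} completable =
    subst (CompletableIn G (∑ n ms)) length-glued
      (completableIn-fromList G glued
        (Complete⇒IsoToComplete (JoinV↔Fin∑ n ms) (afterExplosions-irreflexive G glued) glued-complete))
    where
    completion : ∀ i → List (Fin (ms i))
    completion i = toList (proj₁ (completable i))
    glued = glue n ms completion
    length-glued : length glued ≡ ∑ n ℓs
    length-glued = trans (length-glue n ms completion) (∑-cong n (λ i → length-toList (proj₁ (completable i))))
    glued-complete : Complete (afterExplosions G glued)
    glued-complete = Complete-blocks⇒Complete-join glued λ i →
      subst (Complete ∘′ afterExplosions (Gs i)) (sym (restrict-glue n ms completion i))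
        (IsoToComplete⇒Complete (proj₂ (completable i)))

  CompletableIn-join⇒∑≤ : ∀ {ℓs : Fin n → ℕ} {m k} → (∀ i → McPherson (Gs i) (ms i) (ℓs i)) →
    CompletableIn G m k → ∑ n ℓs ≤ k
  CompletableIn-join⇒∑≤ {ℓs} {k = k} υ (us , iso) = begin
    ∑ n ℓs                                          ≤⟨ ∑-mono-≤ n blockBound ⟩
    ∑ n (λ i → length (restrict ms i (toList us)))  ≡⟨ ∑-length-restrict ms (toList us) ⟩
    length (toList us)                              ≡⟨ length-toList us ⟩
    k                                               ∎
    where
    open ≤-Reasoning
    blockBound : ∀ i → ℓs i ≤ length (restrict ms i (toList us))
    blockBound i = McPherson-minimal (Gs i) (υ i) (restrict ms i (toList us))
      (Complete⇒IsoToComplete ↔-refl (afterExplosions-irreflexive (Gs i) (restrict ms i (toList us)))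
        (Complete-join⇒Complete-block (toList us) i (IsoToComplete⇒Complete iso)))

corollary2p9 : (n : ℕ) (ms : Fin n → ℕ) (Gs : (i : Fin n) → Graph (Fin (ms i)))
    → (∀ i → Connected (Gs i))
    → (ℓs : Fin n → ℕ) → (∀ i → McPherson (Gs i) (ms i) (ℓs i))
    → McPherson (Join ms Gs) (∑ n ms) (∑ n ℓs)
corollary2p9 n ms Gs _ ℓs υ =
  CompletableIn-join-∑ ms Gs (λ i → proj₁ (υ i)) ,
  λ k k<∑ℓ completable → <⇒≱ k<∑ℓ (CompletableIn-join⇒∑≤ ms Gs υ completable)
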